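{- Let $\Gamma$ be a finite, connected, undirected simple graph of valency $b_0$, let $G\le\mathrm{Aut}(\Gamma)$, let $s$ be a positive integer with $s\le\mathrm{diam}(\Gamma)$, and suppose $\Gamma$ is $(G,s)$-geodesic transitive. For $1\le i\le s-1$, let $b_i$ be the number of neighbours of a vertex $v\in\Gamma_i(u)$ lying in $\Gamma_{i+1}(u)$ (this number does not depend on the choice of $u$ and $v\in\Gamma_i(u)$). Then for every vertex $u\in V(\Gamma)$, the product $b_0b_1\cdots b_{s-1}$ divides $|G_u|$.
   Context: For vertices $u,v$, $d_\Gamma(u,v)$ is the length of a shortest path from $u$ to $v$; $\mathrm{diam}(\Gamma)$ is the maximum distance between two vertices; $\Gamma_i(u)=\{v\in V(\Gamma): d_\Gamma(u,v)=i\}$. An $s$-arc is a sequence of vertices $(u_0,\dots,u_s)$ with $u_i$ adjacent to $u_{i+1}$ for $0\le i\le s-1$ and $u_{j-1}\ne u_{j+1}$ for $1\le j\le s-1$; it is an $s$-geodesic if $d_\Gamma(u_0,u_s)=s$. For $G\le\mathrm{Aut}(\Gamma)$, $\Gamma$ is $(G,s)$-geodesic transitive if $G$ is transitive on $V(\Gamma)$ and, for each $1\le i\le s$, $\Gamma$ has at least one $i$-geodesic and $G$ is transitive on the set of all $i$-geodesics. $G_u$ denotes the stabilizer of the vertex $u$ in $G$. -}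

module Defs where

open import Data.Nat using (ℕ; zero; suc; _*_; _≤_; _∸_)
open import Data.Fin using (Fin)
open import Data.Vec using (Vec; []; _∷_; lookup; tabulate; map; head; last)
open import Data.List using (List; length)
open import Data.List.Membership.Propositional using (_∈_)
open import Data.List.Relation.Unary.Unique.Propositional using (Unique)
open import Data.Product using (Σ; ∃; _×_; _,_)
open import Data.Empty using (⊥)
open import Relation.Nullary using (¬_)
open import Relation.Binary.PropositionalEquality using (_≡_; _≢_)
open import Function.Bundles using (_⇔_)

record Graph (n : ℕ) : Set₁ where
  field
    Adj     : Fin n → Fin n → Set
    symAdj  : ∀ {x y} → Adj x y → Adj y x
    irrefl  : ∀ {x} → ¬ Adj x x

module _ {n : ℕ} (Γ : Graph n) where
  open Graph Γ

  IsWalk : ∀ {k} → Vec (Fin n) (suc k) → Set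
  IsWalk (x ∷ []) = Data.Unit.⊤ where import Data.Unit
  IsWalk (x ∷ y ∷ p) = Adj x y × IsWalk (y ∷ p)

  NonBacktracking : ∀ {k} → Vec (Fin n) (suc k) → Set
  NonBacktracking (x ∷ y ∷ z ∷ p) = x ≢ z × NonBacktracking (y ∷ z ∷ p)
  NonBacktracking _ = Data.Unit.⊤ where import Data.Unit

  IsArc : ∀ {k} → Vec (Fin n) (suc k) → Set
  IsArc p = IsWalk p × NonBacktracking p

  WalkOfLength : Fin n → Fin n → ℕ → Set
  WalkOfLength u v k = Σ (Vec (Fin n) (suc k)) λ p → IsWalk p × head p ≡ u × last p ≡ v

  Dist : Fin n → Fin n → ℕ → Set
  Dist u v k = WalkOfLength u v k × (∀ j → WalkOfLength u v j → k ≤ j)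

  Connected : Set
  Connected = ∀ u v → ∃ λ k → WalkOfLength u v k

  DiamAtLeast : ℕ → Set
  DiamAtLeast s = ∃ λ u → ∃ λ v → ∃ λ d → Dist u v d × s ≤ d

  IsGeodesic : ∀ {k} → Vec (Fin n) (suc k) → Set
  IsGeodesic {k} p = IsArc p × Dist (head p) (last p) k

HasSize : {A : Set} → (A → Set) → ℕ → Set
HasSize {A} P k = Σ (List A) λ l → Unique l × (∀ x → (x ∈ l) ⇔ P x) × length l ≡ k

module _ {n : ℕ} (Γ : Graph n) where
  open Graph Γ

  Regular : ℕ → Set
  Regular b₀ = ∀ v → HasSize (λ w → Adj v w) b₀

-- Maps Fin n → Fin n, represented by their value tables.
Map : ℕ → Set
Map n = Vec (Fin n) n

app : ∀ {n} → Map n → Fin n → Fin n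
app g x = lookup g x

idMap : ∀ {n} → Map n
idMap = tabulate (λ x → x)

_∘ₘ_ : ∀ {n} → Map n → Map n → Map n
g ∘ₘ h = tabulate (λ x → app g (app h x))

module _ {n : ℕ} (Γ : Graph n) where
  open Graph Γ

  IsAutomorphism : Map n → Set
  IsAutomorphism g = (∀ x y → app g x ≡ app g y → x ≡ y)
                   × (∀ x y → Adj x y ⇔ Adj (app g x) (app g y))

  -- A (necessarily finite) subgroup G ≤ Aut(Γ), given as a duplicate-free list
  -- of automorphisms containing the identity and closed under composition
  -- and inverses.
  record Subgroup : Set where
    field
      elems    : List (Map n)
      unique   : Unique elems
      autos    : ∀ g → g ∈ elems → IsAutomorphism g
      hasId    : idMap ∈ elems
      closed   : ∀ g h → g ∈ elems → h ∈ elems → (g ∘ₘ h) ∈ elems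
      inverses : ∀ g → g ∈ elems → ∃ λ h → h ∈ elems × (g ∘ₘ h) ≡ idMap

  module _ (G : Subgroup) where
    open Subgroup G

    VertexTransitive : Set
    VertexTransitive = ∀ u v → ∃ λ g → g ∈ elems × app g u ≡ v

    GeodesicTransitive : ℕ → Set
    GeodesicTransitive s =
      VertexTransitive ×
      (∀ i → 1 ≤ i → i ≤ s →
         (∃ λ (p : Vec (Fin n) (suc i)) → IsGeodesic Γ p) ×
         (∀ (p q : Vec (Fin n) (suc i)) → IsGeodesic Γ p → IsGeodesic Γ q →
            ∃ λ g → g ∈ elems × map (app g) p ≡ q))

    StabilizerSize : Fin n → ℕ → Set
    StabilizerSize u k = HasSize (λ g → g ∈ elems × app g u ≡ u) k

-- b 0 * b 1 * … * b (s-1)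
prodUpTo : (ℕ → ℕ) → ℕ → ℕ
prodUpTo b zero = 1
prodUpTo b (suc k) = prodUpTo b k * b k

{-# OPTIONS --safe #-}
module Submission where

-- Fix a geodesic u = x₀, x₁, …, x_s; one exists because diam Γ ≥ s and G is vertex-transitive.
-- Let Gᵢ ≤ G_u be the pointwise stabiliser of x₀, …, xᵢ. For i < s every g ∈ Gᵢ sends x_{i+1} to
-- one of the bᵢ neighbours w of xᵢ with d(u,w) = i+1, and (i+1)-geodesic transitivity gives for
-- each such w some h ∈ Gᵢ with h x_{i+1} = w, so that the fibre over w is the coset h G_{i+1}.
-- Hence |Gᵢ| = bᵢ |G_{i+1}|, and |G_u| = b₀ b₁ ⋯ b_{s-1} |G_s|.

open import Defs
open import Data.Nat using (ℕ; zero; suc; _+_; _*_; _≤_; _<_; _∸_; z≤n; s≤s; _≤?_)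
open import Data.Nat.Properties hiding (_≟_)
open import Data.Nat.Divisibility using (_∣_; divides)
open import Data.Fin using (Fin)
open import Data.Fin.Properties using (_≟_)
open import Data.Vec using (Vec; []; _∷_; head; last; map; tail; tabulate)
open import Data.Vec.Properties using (lookup∘tabulate; tabulate∘lookup; tabulate-cong)
open import Data.List using (List; []; _∷_; length; filter)
import Data.List as List
open import Data.List.Properties using (length-map)
open import Data.List.Membership.Propositional using (_∈_)
open import Data.List.Membership.Propositional.Properties using (∈-filter⁺; ∈-filter⁻; ∈-map⁺; ∈-map⁻)
open import Data.List.Membership.Propositional.Properties.WithK using (unique∧set⇒bag)
open import Data.List.Relation.Binary.BagAndSetEquality using (∼bag⇒↭)
open import Data.List.Relation.Binary.Permutation.Propositional.Properties using (↭-length)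
open import Data.List.Relation.Unary.Any using (here; there)
import Data.List.Relation.Unary.All as All
open import Data.List.Relation.Unary.AllPairs using (_∷_)
open import Data.List.Relation.Unary.Unique.Propositional using (Unique)
import Data.List.Relation.Unary.Unique.Propositional.Properties as Unique
open import Data.Product using (Σ; ∃; _×_; _,_; proj₁; proj₂)
open import Data.Sum using (inj₁; inj₂)
open import Data.Unit using (tt)
open import Function using (_∘_)
open import Function.Bundles using (_⇔_; mk⇔; Equivalence)
open import Function.Construct.Composition using (_⇔-∘_)
open import Relation.Binary.Definitions using (DecidableEquality)
open import Relation.Binary.PropositionalEquality
open import Relation.Nullary using (yes; no; ¬?)
open import Relation.Nullary.Negation using (contradiction)

open Equivalence using (to; from)
open ≡-Reasoning

private variable
  A B : Set

length-≡-of-∈⇔ : {xs ys : List A} → Unique xs → Unique ys →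
                 (∀ {z} → z ∈ xs ⇔ z ∈ ys) → length xs ≡ length ys
length-≡-of-∈⇔ xs! ys! xs⇔ys = ↭-length (∼bag⇒↭ (unique∧set⇒bag xs! ys! xs⇔ys))

HasSize-cong : {P Q : A → Set} {m : ℕ} → (∀ a → P a ⇔ Q a) → HasSize P m → HasSize Q m
HasSize-cong P⇔Q (xs , xs! , ∈xs⇔P , len) = xs , xs! , (λ a → P⇔Q a ⇔-∘ ∈xs⇔P a) , len

module Fibres {A B : Set} (_≟ᴮ_ : DecidableEquality B) (f : A → B) where

  fibre : B → List A → List A
  fibre b = filter (λ a → f a ≟ᴮ b)

  private
    outside : B → List A → List A
    outside b = filter (λ a → ¬? (f a ≟ᴮ b))

    length-fibre-+-outside : ∀ b xs → length (fibre b xs) + length (outside b xs) ≡ length xs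
    length-fibre-+-outside b [] = refl
    length-fibre-+-outside b (a ∷ xs) with f a ≟ᴮ b
    ... | yes _ = cong suc (length-fibre-+-outside b xs)
    ... | no  _ = trans (+-suc _ _) (cong suc (length-fibre-+-outside b xs))

    fibre-outside : ∀ {b c} → c ≢ b → ∀ xs → fibre c (outside b xs) ≡ fibre c xs
    fibre-outside c≢b [] = refl
    fibre-outside {b} {c} c≢b (a ∷ xs) with f a ≟ᴮ b
    ... | yes refl with f a ≟ᴮ c
    ...   | yes refl = contradiction refl c≢b
    ...   | no  _    = fibre-outside c≢b xs
    fibre-outside {b} {c} c≢b (a ∷ xs) | no _ with f a ≟ᴮ c
    ...   | yes _ = cong (a ∷_) (fibre-outside c≢b xs)
    ...   | no  _ = fibre-outside c≢b xs

  length-≡-*-fibre : ∀ {c} (W : List B) → Unique W → ∀ xs →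
                     (∀ {a} → a ∈ xs → f a ∈ W) → (∀ {b} → b ∈ W → length (fibre b xs) ≡ c) →
                     length xs ≡ length W * c
  length-≡-*-fibre [] _ [] _ _ = refl
  length-≡-*-fibre [] _ (a ∷ _) into _ with () ← into (here refl)
  length-≡-*-fibre {c} (b ∷ W) (b∉W ∷ W!) xs into fibre-size = begin
    length xs                                    ≡⟨ length-fibre-+-outside b xs ⟨
    length (fibre b xs) + length (outside b xs)  ≡⟨ cong₂ _+_ (fibre-size (here refl))
                                                      (length-≡-*-fibre W W! (outside b xs) into′ fibre-size′) ⟩
    c + length W * c                             ∎
    where
      into′ : ∀ {a} → a ∈ outside b xs → f a ∈ W
      into′ a∈ with ∈-filter⁻ (λ a → ¬? (f a ≟ᴮ b)) {xs = xs} a∈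
      ... | a∈xs , fa≢b with into a∈xs
      ... | here fa≡b  = contradiction fa≡b fa≢b
      ... | there fa∈W = fa∈W

      fibre-size′ : ∀ {b′} → b′ ∈ W → length (fibre b′ (outside b xs)) ≡ c
      fibre-size′ b′∈W = begin
        length (fibre _ (outside b xs)) ≡⟨ cong length (fibre-outside (All.lookup b∉W b′∈W ∘ sym) xs) ⟩
        length (fibre _ xs)             ≡⟨ fibre-size (there b′∈W) ⟩
        c                               ∎

  HasSize⇒length-≡-*-fibre : ∀ {P : B → Set} {m c} → HasSize P m → ∀ xs →
                          (∀ {a} → a ∈ xs → P (f a)) → (∀ {b} → P b → length (fibre b xs) ≡ c) →
                          length xs ≡ m * c
  HasSize⇒length-≡-*-fibre (W , W! , ∈W⇔P , refl) xs into fibre-size =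
    length-≡-*-fibre W W! xs (λ a∈ → from (∈W⇔P _) (into a∈)) (λ b∈ → fibre-size (to (∈W⇔P _) b∈))

module _ {n : ℕ} where

  app-∘ₘ : (g h : Map n) (x : Fin n) → app (g ∘ₘ h) x ≡ app g (app h x)
  app-∘ₘ g h = lookup∘tabulate _

  app-idMap : (x : Fin n) → app idMap x ≡ x
  app-idMap = lookup∘tabulate _

  Map-ext : {g h : Map n} → (∀ x → app g x ≡ app h x) → g ≡ h
  Map-ext {g} {h} g≗h = begin
    g                ≡⟨ tabulate∘lookup g ⟨
    tabulate (app g) ≡⟨ tabulate-cong g≗h ⟩
    tabulate (app h) ≡⟨ tabulate∘lookup h ⟩
    h                ∎

vecUpTo : (ℕ → A) → (m : ℕ) → Vec A (suc m)
vecUpTo x zero    = x 0 ∷ []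
vecUpTo x (suc m) = x 0 ∷ vecUpTo (x ∘ suc) m

head-vecUpTo : ∀ (x : ℕ → A) m → head (vecUpTo x m) ≡ x 0
head-vecUpTo x zero    = refl
head-vecUpTo x (suc m) = refl

last-vecUpTo : ∀ (x : ℕ → A) m → last (vecUpTo x m) ≡ x m
last-vecUpTo x zero          = refl
last-vecUpTo x (suc zero)    = refl
last-vecUpTo x (suc (suc m)) = last-vecUpTo (x ∘ suc) (suc m)

map-vecUpTo : (f : A → B) (x : ℕ → A) (m : ℕ) → map f (vecUpTo x m) ≡ vecUpTo (f ∘ x) m
map-vecUpTo f x zero    = refl
map-vecUpTo f x (suc m) = cong (f (x 0) ∷_) (map-vecUpTo f (x ∘ suc) m)

vecUpTo-injective : ∀ (x y : ℕ → A) m → vecUpTo x m ≡ vecUpTo y m → ∀ {j} → j ≤ m → x j ≡ y j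
vecUpTo-injective x y zero    eq {zero}  _         = cong head eq
vecUpTo-injective x y (suc m) eq {zero}  _         = cong head eq
vecUpTo-injective x y (suc m) eq {suc j} (s≤s j≤m) =
  vecUpTo-injective (x ∘ suc) (y ∘ suc) m (cong tail eq) j≤m

extendAfter : (ℕ → A) → ℕ → A → ℕ → A
extendAfter x i w j with j ≤? i
... | yes _ = x j
... | no  _ = w

extendAfter-≤ : ∀ (x : ℕ → A) {i w j} → j ≤ i → extendAfter x i w j ≡ x j
extendAfter-≤ x {i} {j = j} j≤i with j ≤? i
... | yes _   = refl
... | no  j≰i = contradiction j≤i j≰i

extendAfter-suc : ∀ (x : ℕ → A) i w → extendAfter x i w (suc i) ≡ w
extendAfter-suc x i w with suc i ≤? i
... | yes i<i = contradiction i<i (n≮n i)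
... | no  _   = refl

module Walks {n : ℕ} (Γ : Graph n) where
  open Graph Γ

  private variable
    a b c : Fin n
    i j k : ℕ

  infixr 5 _◅_
  data Walk : Fin n → Fin n → ℕ → Set where
    ε   : Walk a a 0
    _◅_ : Adj a b → Walk b c k → Walk a c (suc k)

  private
    toVec : Walk a b k → Vec (Fin n) (suc k)
    toVec {a} ε       = a ∷ []
    toVec {a} (_ ◅ w) = a ∷ toVec w

    IsWalk-toVec : (w : Walk a b k) → IsWalk Γ (toVec w)
    IsWalk-toVec ε               = tt
    IsWalk-toVec (e ◅ ε)         = e , tt
    IsWalk-toVec (e ◅ w@(_ ◅ _)) = e , IsWalk-toVec w

    head-toVec : (w : Walk a b k) → head (toVec w) ≡ a
    head-toVec ε       = refl
    head-toVec (_ ◅ _) = refl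

    last-toVec : (w : Walk a b k) → last (toVec w) ≡ b
    last-toVec ε               = refl
    last-toVec (_ ◅ ε)         = refl
    last-toVec (_ ◅ w@(_ ◅ _)) = last-toVec w

    fromVec : (p : Vec (Fin n) (suc k)) → IsWalk Γ p → Walk (head p) (last p) k
    fromVec (_ ∷ [])     _        = ε
    fromVec (_ ∷ y ∷ p) (e , walk) = e ◅ fromVec (y ∷ p) walk

  Walk⇒WalkOfLength : Walk a b k → WalkOfLength Γ a b k
  Walk⇒WalkOfLength w = toVec w , IsWalk-toVec w , head-toVec w , last-toVec w

  WalkOfLength⇒Walk : WalkOfLength Γ a b k → Walk a b k
  WalkOfLength⇒Walk (p , walk , refl , refl) = fromVec p walk

  Minimal : Fin n → Fin n → ℕ → Set
  Minimal a b k = ∀ {j} → Walk a b j → k ≤ j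

  Dist⇒Walk : Dist Γ a b k → Walk a b k
  Dist⇒Walk = WalkOfLength⇒Walk ∘ proj₁

  Dist⇒Minimal : Dist Γ a b k → Minimal a b k
  Dist⇒Minimal (_ , minimal) w = minimal _ (Walk⇒WalkOfLength w)

  mkDist : Walk a b k → Minimal a b k → Dist Γ a b k
  mkDist w minimal = Walk⇒WalkOfLength w , λ _ p → minimal (WalkOfLength⇒Walk p)

  Dist-unique : Dist Γ a b j → Dist Γ a b k → j ≡ k
  Dist-unique (p , minimal) (q , minimal′) = ≤-antisym (minimal _ q) (minimal′ _ p)

  Dist-zero : Dist Γ a b 0 → a ≡ b
  Dist-zero d with Dist⇒Walk d
  ... | ε = refl

  Dist-adj : Adj a b → Dist Γ a b 1
  Dist-adj a~b = mkDist (a~b ◅ ε) λ { ε → contradiction a~b irrefl ; (_ ◅ _) → s≤s z≤n }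

  infixr 5 _++ʷ_
  _++ʷ_ : Walk a b j → Walk b c k → Walk a c (j + k)
  ε       ++ʷ v = v
  (e ◅ w) ++ʷ v = e ◅ (w ++ʷ v)

  vertex : Walk a b k → ℕ → Fin n
  vertex {a} ε       _       = a
  vertex {a} (_ ◅ _) zero    = a
  vertex     (_ ◅ w) (suc j) = vertex w j

  vertex-zero : (w : Walk a b k) → vertex w 0 ≡ a
  vertex-zero ε       = refl
  vertex-zero (_ ◅ _) = refl

  vertex-adj : (w : Walk a b k) → j < k → Adj (vertex w j) (vertex w (suc j))
  vertex-adj {j = zero}  (e ◅ w) _         = subst (Adj _) (sym (vertex-zero w)) e
  vertex-adj {j = suc j} (_ ◅ w) (s≤s j<k) = vertex-adj w j<k

  take : (w : Walk a b k) → j ≤ k → Walk a (vertex w j) j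
  take {j = zero}  ε       _         = ε
  take {j = zero}  (_ ◅ _) _         = ε
  take {j = suc j} (e ◅ w) (s≤s j≤k) = e ◅ take w j≤k

  drop : (w : Walk a b k) → j ≤ k → Walk (vertex w j) b (k ∸ j)
  drop {j = zero}  ε       _         = ε
  drop {j = zero}  (e ◅ w) _         = e ◅ w
  drop {j = suc j} (_ ◅ w) (s≤s j≤k) = drop w j≤k

  Dist-vertex : (w : Walk a b k) → Minimal a b k → j ≤ k → Dist Γ a (vertex w j) j
  Dist-vertex {k = k} {j = j} w minimal j≤k = mkDist (take w j≤k) λ {i} v →
    +-cancelʳ-≤ (k ∸ j) j i (≤-trans (≤-reflexive (m+[n∸m]≡n j≤k)) (minimal (v ++ʷ drop w j≤k)))

  mapWalk : (g : Map n) → (∀ {x y} → Adj x y → Adj (app g x) (app g y)) →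
            Walk a b k → Walk (app g a) (app g b) k
  mapWalk g g-adj ε       = ε
  mapWalk g g-adj (e ◅ w) = g-adj e ◅ mapWalk g g-adj w

  Dist-map : (g h : Map n) → IsAutomorphism Γ g → IsAutomorphism Γ h →
             (∀ x → app h (app g x) ≡ x) → Dist Γ a b k → Dist Γ (app g a) (app g b) k
  Dist-map g h (_ , g-adj) (_ , h-adj) h∘g≗id d =
    mkDist (mapWalk g (to (g-adj _ _)) (Dist⇒Walk d)) λ v →
      Dist⇒Minimal d (subst₂ (λ a b → Walk a b _) (h∘g≗id _) (h∘g≗id _) (mapWalk h (to (h-adj _ _)) v))

  private
    IsWalk-vecUpTo : ∀ x m → (∀ {j} → j < m → Adj (x j) (x (suc j))) → IsWalk Γ (vecUpTo x m)
    IsWalk-vecUpTo x zero          _   = tt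
    IsWalk-vecUpTo x (suc zero)    adj = adj (s≤s z≤n) , tt
    IsWalk-vecUpTo x (suc (suc m)) adj = adj (s≤s z≤n) , IsWalk-vecUpTo (x ∘ suc) (suc m) (adj ∘ s≤s)

    NonBacktracking-vecUpTo : ∀ x m → (∀ {j} → suc (suc j) ≤ m → x j ≢ x (suc (suc j))) →
                              NonBacktracking Γ (vecUpTo x m)
    NonBacktracking-vecUpTo x zero                _  = tt
    NonBacktracking-vecUpTo x (suc zero)          _  = tt
    NonBacktracking-vecUpTo x (suc (suc zero))    nb = nb (s≤s (s≤s z≤n)) , tt
    NonBacktracking-vecUpTo x (suc (suc (suc m))) nb =
      nb (s≤s (s≤s z≤n)) , NonBacktracking-vecUpTo (x ∘ suc) (suc (suc m)) (nb ∘ s≤s)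

  record GeodesicFrom (u : Fin n) (s : ℕ) : Set where
    field
      vertexAt : ℕ → Fin n
      adjacent : ∀ {j} → j < s → Adj (vertexAt j) (vertexAt (suc j))
      distance : ∀ {j} → j ≤ s → Dist Γ u (vertexAt j) j

    starts : vertexAt 0 ≡ u
    starts = sym (Dist-zero (distance z≤n))

  open GeodesicFrom public

  fromShortestWalk : (w : Walk a b k) → Minimal a b k → GeodesicFrom a k
  fromShortestWalk w minimal = record
    { vertexAt = vertex w
    ; adjacent = vertex-adj w
    ; distance = Dist-vertex w minimal
    }

  restrict : ∀ {u s} → i ≤ s → GeodesicFrom u s → GeodesicFrom u i
  restrict i≤s γ = record
    { vertexAt = vertexAt γ
    ; adjacent = λ j<i → adjacent γ (≤-trans j<i i≤s)
    ; distance = λ j≤i → distance γ (≤-trans j≤i i≤s)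
    }

  extend : ∀ {u w} (γ : GeodesicFrom u i) → Adj (vertexAt γ i) w → Dist Γ u w (suc i) →
           GeodesicFrom u (suc i)
  extend {i} {u} {w} γ γᵢ~w d = record { vertexAt = y ; adjacent = adjacent′ ; distance = distance′ }
    where
      y : ℕ → Fin n
      y = extendAfter (vertexAt γ) i w

      y-≤ : ∀ {j} → j ≤ i → y j ≡ vertexAt γ j
      y-≤ = extendAfter-≤ (vertexAt γ)

      y-suc : y (suc i) ≡ w
      y-suc = extendAfter-suc (vertexAt γ) i w

      adjacent′ : ∀ {j} → j < suc i → Adj (y j) (y (suc j))
      adjacent′ j<1+i with m≤n⇒m<n∨m≡n (m<1+n⇒m≤n j<1+i)
      ... | inj₁ j<i  = subst₂ Adj (sym (y-≤ (<⇒≤ j<i))) (sym (y-≤ j<i)) (adjacent γ j<i)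
      ... | inj₂ refl = subst₂ Adj (sym (y-≤ ≤-refl)) (sym y-suc) γᵢ~w

      distance′ : ∀ {j} → j ≤ suc i → Dist Γ u (y j) j
      distance′ j≤1+i with m≤n⇒m<n∨m≡n j≤1+i
      ... | inj₁ j<1+i = let j≤i = m<1+n⇒m≤n j<1+i in
                         subst (λ v → Dist Γ u v _) (sym (y-≤ j≤i)) (distance γ j≤i)
      ... | inj₂ refl  = subst (λ v → Dist Γ u v _) (sym y-suc) d

  mapGeodesicFrom : ∀ {u s} (g h : Map n) → IsAutomorphism Γ g → IsAutomorphism Γ h →
                    (∀ x → app h (app g x) ≡ x) → GeodesicFrom u s → GeodesicFrom (app g u) s
  mapGeodesicFrom g h g-aut@(_ , g-adj) h-aut h∘g≗id γ = record
    { vertexAt = app g ∘ vertexAt γ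
    ; adjacent = to (g-adj _ _) ∘ adjacent γ
    ; distance = Dist-map g h g-aut h-aut h∘g≗id ∘ distance γ
    }

  IsGeodesic-vecUpTo : ∀ {u s} (γ : GeodesicFrom u s) → IsGeodesic Γ (vecUpTo (vertexAt γ) s)
  IsGeodesic-vecUpTo {u} {s} γ =
    (IsWalk-vecUpTo x s (adjacent γ) , NonBacktracking-vecUpTo x s no-return) ,
    subst₂ (λ a b → Dist Γ a b s) (sym (trans (head-vecUpTo x s) (starts γ))) (sym (last-vecUpTo x s))
      (distance γ ≤-refl)
    where
      x = vertexAt γ

      no-return : ∀ {j} → suc (suc j) ≤ s → x j ≢ x (suc (suc j))
      no-return {j} 2+j≤s xⱼ≡xⱼ₊₂ = m≢1+n+m j (Dist-unique (distance γ (≤-trans (m≤n+m j 2) 2+j≤s))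
        (subst (λ v → Dist Γ u v (suc (suc j))) (sym xⱼ≡xⱼ₊₂) (distance γ 2+j≤s)))

  forwardDegrees : ∀ {s u} (b : ℕ → ℕ) (γ : GeodesicFrom u s) → Regular Γ (b 0) →
                   (∀ i → 1 ≤ i → i ≤ s ∸ 1 → ∀ u v → Dist Γ u v i →
                      HasSize (λ w → Adj v w × Dist Γ u w (suc i)) (b i)) →
                   ∀ {i} → i < s → HasSize (λ w → Adj (vertexAt γ i) w × Dist Γ u w (suc i)) (b i)
  forwardDegrees {u = u} b γ regular _ {zero} _ = HasSize-cong u~w⇔x₀~w (regular u)
    where
      u~w⇔x₀~w : ∀ w → Adj u w ⇔ (Adj (vertexAt γ 0) w × Dist Γ u w 1)
      u~w⇔x₀~w w = mk⇔ (λ u~w → subst (λ v → Adj v w) (sym (starts γ)) u~w , Dist-adj u~w)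
                       (λ (x₀~w , _) → subst (λ v → Adj v w) (starts γ) x₀~w)
  forwardDegrees {u = u} b γ _ degree {suc i} 1+i<s =
    degree (suc i) (s≤s z≤n) (pred-mono-≤ 1+i<s) u (vertexAt γ (suc i)) (distance γ (<⇒≤ 1+i<s))

module SubgroupProperties {n : ℕ} {Γ : Graph n} (G : Subgroup Γ) where
  open Subgroup G
  open Walks Γ

  inverse : ∀ {g} → g ∈ elems →
            Σ (Map n) λ h → h ∈ elems × (∀ x → app g (app h x) ≡ x) × (∀ x → app h (app g x) ≡ x)
  inverse {g} g∈ with inverses g g∈
  ... | h , h∈ , g∘h≡id = h , h∈ , g∘h≗id , λ x → proj₁ (autos g g∈) _ _ (g∘h≗id (app g x))
    where
      g∘h≗id : ∀ x → app g (app h x) ≡ x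
      g∘h≗id x = begin
        app g (app h x)  ≡⟨ app-∘ₘ g h x ⟨
        app (g ∘ₘ h) x   ≡⟨ cong (λ m → app m x) g∘h≡id ⟩
        app idMap x      ≡⟨ app-idMap x ⟩
        x                ∎

  ∘ₘ-cancelˡ : ∀ {g h₁ h₂} → g ∈ elems → g ∘ₘ h₁ ≡ g ∘ₘ h₂ → h₁ ≡ h₂
  ∘ₘ-cancelˡ {g} {h₁} {h₂} g∈ eq = Map-ext λ x → proj₁ (autos g g∈) _ _ (begin
    app g (app h₁ x) ≡⟨ app-∘ₘ g h₁ x ⟨
    app (g ∘ₘ h₁) x  ≡⟨ cong (λ m → app m x) eq ⟩
    app (g ∘ₘ h₂) x  ≡⟨ app-∘ₘ g h₂ x ⟩
    app g (app h₂ x) ∎)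

  Dist-invariant : ∀ {g a b k} → g ∈ elems → Dist Γ a b k → Dist Γ (app g a) (app g b) k
  Dist-invariant {g} g∈ with inverse g∈
  ... | h , h∈ , _ , h∘g≗id = Dist-map g h (autos g g∈) (autos h h∈) h∘g≗id

  geodesicFrom : ∀ {s} → VertexTransitive Γ G → DiamAtLeast Γ s → ∀ u → GeodesicFrom u s
  geodesicFrom vt (a , b , d , a↝b , s≤d) u with vt a u
  ... | g , g∈ , refl with inverse g∈
  ... | h , h∈ , _ , h∘g≗id =
    mapGeodesicFrom g h (autos g g∈) (autos h h∈) h∘g≗id
      (restrict s≤d (fromShortestWalk (Dist⇒Walk a↝b) (Dist⇒Minimal a↝b)))

module StabiliserChain {n : ℕ} {Γ : Graph n} (G : Subgroup Γ) {s : ℕ} {u : Fin n}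
    (transitive : ∀ i → 1 ≤ i → i ≤ s → ∀ (p q : Vec (Fin n) (suc i)) →
                  IsGeodesic Γ p → IsGeodesic Γ q → ∃ λ g → g ∈ Subgroup.elems G × map (app g) p ≡ q)
    (γ : Walks.GeodesicFrom Γ u s)
    (stabiliser : List (Map n)) (stabiliser! : Unique stabiliser)
    (∈stabiliser⇔ : ∀ g → g ∈ stabiliser ⇔ (g ∈ Subgroup.elems G × app g u ≡ u))
  where
  open Graph Γ
  open Subgroup G
  open Walks Γ
  open SubgroupProperties G

  private
    x : ℕ → Fin n
    x = vertexAt γ

  Fixes : Map n → ℕ → Set
  Fixes g i = ∀ {j} → j ≤ i → app g (x j) ≡ x j

  Fixes⇒fixes-u : ∀ {g i} → Fixes g i → app g u ≡ u
  Fixes⇒fixes-u {g} fix = subst (λ v → app g v ≡ v) (starts γ) (fix z≤n)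

  fixes-u⇒Fixes-0 : ∀ {g} → app g u ≡ u → Fixes g 0
  fixes-u⇒Fixes-0 {g} gu≡u z≤n = subst (λ v → app g v ≡ v) (sym (starts γ)) gu≡u

  Fixes-suc : ∀ {g i} → Fixes g i → app g (x (suc i)) ≡ x (suc i) → Fixes g (suc i)
  Fixes-suc fix fix′ j≤1+i with m≤n⇒m<n∨m≡n j≤1+i
  ... | inj₁ j<1+i = fix (m<1+n⇒m≤n j<1+i)
  ... | inj₂ refl  = fix′

  Fixes-∘ₘ : ∀ {g h i} → Fixes g i → Fixes h i → Fixes (g ∘ₘ h) i
  Fixes-∘ₘ {g} {h} g-fix h-fix {j} j≤i = begin
    app (g ∘ₘ h) (x j) ≡⟨ app-∘ₘ g h (x j) ⟩
    app g (app h (x j)) ≡⟨ cong (app g) (h-fix j≤i) ⟩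
    app g (x j)         ≡⟨ g-fix j≤i ⟩
    x j                 ∎

  Fixes-inverse : ∀ {h h⁻¹ i} → (∀ y → app h⁻¹ (app h y) ≡ y) → Fixes h i → Fixes h⁻¹ i
  Fixes-inverse {h} {h⁻¹} h⁻¹∘h≗id h-fix {j} j≤i = begin
    app h⁻¹ (x j)         ≡⟨ cong (app h⁻¹) (h-fix j≤i) ⟨
    app h⁻¹ (app h (x j)) ≡⟨ h⁻¹∘h≗id (x j) ⟩
    x j                   ∎

  at : ℕ → Map n → Fin n
  at j g = app g (x j)

  Stab : ℕ → List (Map n)
  Stab zero    = stabiliser
  Stab (suc i) = filter (λ g → at (suc i) g ≟ x (suc i)) (Stab i)

  Stab-unique : ∀ i → Unique (Stab i)
  Stab-unique zero    = stabiliser!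
  Stab-unique (suc i) = Unique.filter⁺ _ (Stab-unique i)

  ∈-Stab⁻ : ∀ i {g} → g ∈ Stab i → g ∈ elems × Fixes g i
  ∈-Stab⁻ zero {g} g∈ with to (∈stabiliser⇔ _) g∈
  ... | g∈G , gu≡u = g∈G , fixes-u⇒Fixes-0 {g} gu≡u
  ∈-Stab⁻ (suc i) {g} g∈ with ∈-filter⁻ (λ g → at (suc i) g ≟ x (suc i)) {xs = Stab i} g∈
  ... | g∈Stabᵢ , fix′ with ∈-Stab⁻ i g∈Stabᵢ
  ... | g∈G , fix = g∈G , Fixes-suc {g} fix fix′

  ∈-Stab⁺ : ∀ i {g} → g ∈ elems → Fixes g i → g ∈ Stab i
  ∈-Stab⁺ zero    {g} g∈G fix = from (∈stabiliser⇔ g) (g∈G , Fixes⇒fixes-u {g} fix)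
  ∈-Stab⁺ (suc i) {g} g∈G fix =
    ∈-filter⁺ (λ g → at (suc i) g ≟ x (suc i)) (∈-Stab⁺ i g∈G (fix ∘ m≤n⇒m≤1+n)) (fix ≤-refl)

  open Fibres {A = Map n} {B = Fin n} _≟_

  fixes-and-sends : ∀ {h i w} →
                    map (app h) (vecUpTo x (suc i)) ≡ vecUpTo (extendAfter x i w) (suc i) →
                    Fixes h i × app h (x (suc i)) ≡ w
  fixes-and-sends {h} {i} {w} h-moves =
    (λ j≤i → trans (pointwise (m≤n⇒m≤1+n j≤i)) (extendAfter-≤ x j≤i)) ,
    trans (pointwise ≤-refl) (extendAfter-suc x i w)
    where
      pointwise : ∀ {j} → j ≤ suc i → app h (x j) ≡ extendAfter x i w j
      pointwise = vecUpTo-injective (app h ∘ x) (extendAfter x i w) (suc i)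
                    (trans (sym (map-vecUpTo (app h) x (suc i))) h-moves)

  transporter : ∀ {i w} → i < s → Adj (x i) w → Dist Γ u w (suc i) →
                ∃ λ h → h ∈ elems × Fixes h i × app h (x (suc i)) ≡ w
  transporter {i} i<s xᵢ~w d
    with transitive (suc i) (s≤s z≤n) i<s _ _
           (IsGeodesic-vecUpTo (restrict i<s γ))
           (IsGeodesic-vecUpTo (extend (restrict (<⇒≤ i<s) γ) xᵢ~w d))
  ... | h , h∈ , h-moves = h , h∈ , fixes-and-sends {h} h-moves

  coset⊆fibre : ∀ {i h w g} → h ∈ elems → Fixes h i → app h (x (suc i)) ≡ w →
                g ∈ Stab (suc i) → h ∘ₘ g ∈ fibre (at (suc i)) w (Stab i)
  coset⊆fibre {i} {h} {w} {g} h∈ h-fix h-sends g∈ =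
    let g∈G , g-fix = ∈-Stab⁻ (suc i) g∈
    in ∈-filter⁺ (λ g → at (suc i) g ≟ w)
         (∈-Stab⁺ i (closed h g h∈ g∈G) (Fixes-∘ₘ {h} {g} h-fix (g-fix ∘ m≤n⇒m≤1+n)))
         (begin
           app (h ∘ₘ g) (x (suc i))  ≡⟨ app-∘ₘ h g _ ⟩
           app h (app g (x (suc i))) ≡⟨ cong (app h) (g-fix ≤-refl) ⟩
           app h (x (suc i))         ≡⟨ h-sends ⟩
           w                         ∎)

  fibre⊆coset : ∀ {i h w g} → h ∈ elems → Fixes h i → app h (x (suc i)) ≡ w →
                g ∈ fibre (at (suc i)) w (Stab i) → ∃ λ g′ → g′ ∈ Stab (suc i) × g ≡ h ∘ₘ g′
  fibre⊆coset {i} {h} {w} {g} h∈ h-fix h-sends g∈fibre =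
    let g∈Stabᵢ , g-sends = ∈-filter⁻ (λ g → at (suc i) g ≟ w) {xs = Stab i} g∈fibre
        g∈G , g-fix = ∈-Stab⁻ i g∈Stabᵢ
        h⁻¹ , h⁻¹∈ , h∘h⁻¹≗id , h⁻¹∘h≗id = inverse h∈
        h⁻¹∘g-fixes : app (h⁻¹ ∘ₘ g) (x (suc i)) ≡ x (suc i)
        h⁻¹∘g-fixes = begin
          app (h⁻¹ ∘ₘ g) (x (suc i))  ≡⟨ app-∘ₘ h⁻¹ g _ ⟩
          app h⁻¹ (app g (x (suc i))) ≡⟨ cong (app h⁻¹) (trans g-sends (sym h-sends)) ⟩
          app h⁻¹ (app h (x (suc i))) ≡⟨ h⁻¹∘h≗id _ ⟩
          x (suc i)                   ∎
    in h⁻¹ ∘ₘ g ,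
       ∈-Stab⁺ (suc i) (closed h⁻¹ g h⁻¹∈ g∈G)
         (Fixes-suc {h⁻¹ ∘ₘ g}
           (Fixes-∘ₘ {h⁻¹} {g} (Fixes-inverse {h} {h⁻¹} h⁻¹∘h≗id h-fix) g-fix) h⁻¹∘g-fixes) ,
       Map-ext λ y → begin
         app g y                   ≡⟨ h∘h⁻¹≗id _ ⟨
         app h (app h⁻¹ (app g y)) ≡⟨ cong (app h) (app-∘ₘ h⁻¹ g y) ⟨
         app h (app (h⁻¹ ∘ₘ g) y)  ≡⟨ app-∘ₘ h (h⁻¹ ∘ₘ g) y ⟨
         app (h ∘ₘ (h⁻¹ ∘ₘ g)) y   ∎

  fibre⇔coset : ∀ {i h w} {g : Map n} → h ∈ elems → Fixes h i → app h (x (suc i)) ≡ w →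
                g ∈ fibre (at (suc i)) w (Stab i) ⇔ g ∈ List.map (h ∘ₘ_) (Stab (suc i))
  fibre⇔coset {i} {h} {w} {g} h∈ h-fix h-sends = mk⇔
    (λ g∈fibre → let g′ , g′∈ , g≡hg′ = fibre⊆coset {i} {h} {w} {g} h∈ h-fix h-sends g∈fibre
                 in subst (_∈ List.map (h ∘ₘ_) (Stab (suc i))) (sym g≡hg′) (∈-map⁺ (h ∘ₘ_) g′∈))
    (λ g∈coset → let g′ , g′∈ , g≡hg′ = ∈-map⁻ (h ∘ₘ_) g∈coset
                 in subst (_∈ fibre (at (suc i)) w (Stab i)) (sym g≡hg′)
                      (coset⊆fibre {i} {h} {w} {g′} h∈ h-fix h-sends g′∈))

  length-fibre : ∀ {i w} → i < s → Adj (x i) w → Dist Γ u w (suc i) →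
                 length (fibre (at (suc i)) w (Stab i)) ≡ length (Stab (suc i))
  length-fibre {i} {w} i<s xᵢ~w d with transporter i<s xᵢ~w d
  ... | h , h∈ , h-fix , h-sends = begin
    length (fibre (at (suc i)) w (Stab i))   ≡⟨ length-≡-of-∈⇔ fibre-unique coset-unique
                                                  (fibre⇔coset h∈ h-fix h-sends) ⟩
    length (List.map (h ∘ₘ_) (Stab (suc i))) ≡⟨ length-map _ (Stab (suc i)) ⟩
    length (Stab (suc i))                    ∎
    where
      fibre-unique : Unique (fibre (at (suc i)) w (Stab i))
      fibre-unique = Unique.filter⁺ (λ g → at (suc i) g ≟ w) (Stab-unique i)

      coset-unique : Unique (List.map (h ∘ₘ_) (Stab (suc i)))
      coset-unique = Unique.map⁺ (∘ₘ-cancelˡ h∈) (Stab-unique (suc i))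

  Stab-moves-forward : ∀ {i g} → i < s → g ∈ Stab i →
                       Adj (x i) (at (suc i) g) × Dist Γ u (at (suc i) g) (suc i)
  Stab-moves-forward {i} {g} i<s g∈ with ∈-Stab⁻ i g∈
  ... | g∈G , g-fix =
    subst (λ v → Adj v (at (suc i) g)) (g-fix ≤-refl)
      (to (proj₂ (autos g g∈G) _ _) (adjacent γ i<s)) ,
    subst (λ v → Dist Γ v (at (suc i) g) (suc i)) (Fixes⇒fixes-u {g} g-fix)
      (Dist-invariant g∈G (distance γ i<s))

  length-Stab-suc : ∀ {i m} → i < s → HasSize (λ w → Adj (x i) w × Dist Γ u w (suc i)) m →
                    length (Stab i) ≡ m * length (Stab (suc i))
  length-Stab-suc {i} i<s forward-size =
    HasSize⇒length-≡-*-fibre (at (suc i)) forward-size (Stab i)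
      (Stab-moves-forward i<s) (λ {w} (xᵢ~w , d) → length-fibre {i} {w} i<s xᵢ~w d)

  length-stabiliser : (b : ℕ → ℕ) →
                      (∀ {i} → i < s → HasSize (λ w → Adj (x i) w × Dist Γ u w (suc i)) (b i)) →
                      ∀ {i} → i ≤ s → length stabiliser ≡ prodUpTo b i * length (Stab i)
  length-stabiliser b forward-size {zero}  _   = sym (*-identityˡ _)
  length-stabiliser b forward-size {suc i} i<s = begin
    length stabiliser                            ≡⟨ length-stabiliser b forward-size (<⇒≤ i<s) ⟩
    prodUpTo b i * length (Stab i)               ≡⟨ cong (prodUpTo b i *_)
                                                      (length-Stab-suc i<s (forward-size i<s)) ⟩
    prodUpTo b i * (b i * length (Stab (suc i))) ≡⟨ *-assoc (prodUpTo b i) (b i) _ ⟨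
    prodUpTo b (suc i) * length (Stab (suc i))   ∎

corollary2p6 : (n : ℕ) (Γ : Graph n) (G : Subgroup Γ) (s : ℕ) (b : ℕ → ℕ) →
    Connected Γ → 1 ≤ s → DiamAtLeast Γ s → GeodesicTransitive Γ G s →
    Regular Γ (b 0) →
    (∀ i → 1 ≤ i → i ≤ s ∸ 1 → ∀ u v → Dist Γ u v i →
       HasSize (λ w → Graph.Adj Γ v w × Dist Γ u w (suc i)) (b i)) →
    ∀ (u : Fin n) (k : ℕ) → StabilizerSize Γ G u k → prodUpTo b s ∣ k
corollary2p6 n Γ G s b _ _ diam (vt , gt) regular degree u k (stabiliser , stabiliser! , ∈stabiliser⇔ , refl) =
  divides (length (Stab s))
    (trans (length-stabiliser b (forwardDegrees b γ regular degree) ≤-refl) (*-comm (prodUpTo b s) _))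
  where
    open Walks Γ
    γ : GeodesicFrom u s
    γ = SubgroupProperties.geodesicFrom G vt diam u
    open StabiliserChain G (λ i 1≤i i≤s → proj₂ (gt i 1≤i i≤s)) γ stabiliser stabiliser! ∈stabiliser⇔
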